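{- Let $D_1,D_2$ be directed graphs, let $V_{\mathrm{com}}=V(D_1)\cap V(D_2)$, and let $V_1,V_2$ satisfy $V_{\mathrm{com}}\subseteq V_1\subseteq V(D_1)$ and $V_{\mathrm{com}}\subseteq V_2\subseteq V(D_2)$. Then: (i) $\texttt{Con}(V_1\cup V_2,D_1\cup D_2)=\texttt{trcl}\big(\texttt{Con}(V_1,D_1)\cup\texttt{Con}(V_2,D_2)\big)$; (ii) if $D_1$ and $D_2$ are acyclic and $\texttt{Con}(V_1\cup V_2,D_1\cup D_2)$ is irreflexive, then $D_1\cup D_2$ is acyclic.
   Context: For a digraph $D$ and $V'\subseteq V(D)$, $\texttt{Con}(V',D)=\{(v_1,v_2)\in V'\times V' : \text{there is a directed path from } v_1 \text{ to } v_2 \text{ in } D\}$. $\texttt{trcl}(R)$ denotes the transitive closure of a binary relation $R$. $D_1\cup D_2$ is the digraph with vertex set $V(D_1)\cup V(D_2)$ and arc set $A(D_1)\cup A(D_2)$. -}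

module Defs where

open import Data.Product using (_×_; Σ; ∃)
open import Data.Sum using (_⊎_)
open import Data.Empty using (⊥)
open import Relation.Nullary using (¬_)
open import Relation.Binary.Construct.Closure.Transitive using (TransClosure)

record Digraph (V : Set) : Set₁ where
  field
    vertex  : V → Set
    arc     : V → V → Set
    arc-src : ∀ {u v} → arc u v → vertex u
    arc-tgt : ∀ {u v} → arc u v → vertex v
open Digraph public

Subset : Set → Set₁
Subset V = V → Set

_⊆_ : {V : Set} → Subset V → Subset V → Set
A ⊆ B = ∀ {v} → A v → B v

_∪ₛ_ : {V : Set} → Subset V → Subset V → Subset V
(A ∪ₛ B) v = A v ⊎ B v

_∩ₛ_ : {V : Set} → Subset V → Subset V → Subset V
(A ∩ₛ B) v = A v × B v

BRel : Set → Set₁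
BRel V = V → V → Set

_∪ᵣ_ : {V : Set} → BRel V → BRel V → BRel V
(R ∪ᵣ S) x y = R x y ⊎ S x y

trcl : {V : Set} → BRel V → BRel V
trcl R = TransClosure R

_≐_ : {V : Set} → BRel V → BRel V → Set
R ≐ S = ∀ x y → (R x y → S x y) × (S x y → R x y)

Irreflexive : {V : Set} → BRel V → Set
Irreflexive R = ∀ x → ¬ R x x

_∪ᴰ_ : {V : Set} → Digraph V → Digraph V → Digraph V
D₁ ∪ᴰ D₂ = record
  { vertex  = vertex D₁ ∪ₛ vertex D₂
  ; arc     = arc D₁ ∪ᵣ arc D₂
  ; arc-src = λ { (Data.Sum.inj₁ a) → Data.Sum.inj₁ (arc-src D₁ a)
                ; (Data.Sum.inj₂ a) → Data.Sum.inj₂ (arc-src D₂ a) }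
  ; arc-tgt = λ { (Data.Sum.inj₁ a) → Data.Sum.inj₁ (arc-tgt D₁ a)
                ; (Data.Sum.inj₂ a) → Data.Sum.inj₂ (arc-tgt D₂ a) }
  }

Path : {V : Set} → Digraph V → V → V → Set
Path D = TransClosure (arc D)

Con : {V : Set} → Subset V → Digraph V → BRel V
Con V' D x y = V' x × V' y × Path D x y

Acyclic : {V : Set} → Digraph V → Set
Acyclic D = ∀ v → ¬ Path D v v

-- A path in D₁ ∪ D₂ alternates between maximal segments inside D₁ and inside D₂,
-- and every vertex where it switches sides lies in V(D₁) ∩ V(D₂) ⊆ V₁ ∩ V₂.
-- Cutting the path at these vertices writes a Con(V₁ ∪ V₂, D₁ ∪ D₂)-pair as a chain of
-- Con(V₁, D₁)- and Con(V₂, D₂)-pairs; conversely such chains concatenate to paths.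
-- A cycle of D₁ ∪ D₂ that is not inside one Dᵢ passes through a common vertex w,
-- and rotating it to start at w gives a pair (w, w) in Con(V₁ ∪ V₂, D₁ ∪ D₂).
module Submission where

open import Defs
open import Data.Product using (_×_; _,_)
open import Data.Sum using (inj₁; inj₂)
open import Relation.Binary.Core using (_⇒_)
open import Relation.Binary.Definitions using (Transitive)
open import Relation.Binary.Construct.Closure.Transitive using ([_]; _∷_; _++_)

trcl-least : {V : Set} {R S : BRel V} → R ⇒ S → Transitive S → trcl R ⇒ S
trcl-least R⇒S S-trans [ r ]     = R⇒S r
trcl-least R⇒S S-trans (r ∷ rs) = S-trans (R⇒S r) (trcl-least R⇒S S-trans rs)

trcl-map : {V : Set} {R S : BRel V} → R ⇒ S → trcl R ⇒ trcl S
trcl-map R⇒S = trcl-least (λ r → [ R⇒S r ]) _++_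

path-source : {V : Set} (D : Digraph V) → ∀ {x y} → Path D x y → vertex D x
path-source D [ e ]   = arc-src D e
path-source D (e ∷ _) = arc-src D e

Con-trans : {V : Set} {A : Subset V} {D : Digraph V} → Transitive (Con A D)
Con-trans (ax , _ , p) (_ , az , q) = ax , az , p ++ q

module Union {V : Set} (D₁ D₂ : Digraph V) where

  Common : Subset V
  Common = vertex D₁ ∩ₛ vertex D₂

  data Crossing (x y : V) : Set where
    inside₁ : Path D₁ x y → Crossing x y
    inside₂ : Path D₂ x y → Crossing x y
    through : ∀ {w} → Common w → Path (D₁ ∪ᴰ D₂) x w → Path (D₁ ∪ᴰ D₂) w y → Crossing x y

  crossing : ∀ {x y} → Path (D₁ ∪ᴰ D₂) x y → Crossing x y
  crossing [ inj₁ e ] = inside₁ [ e ]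
  crossing [ inj₂ e ] = inside₂ [ e ]
  crossing (inj₁ e ∷ p) with crossing p
  ... | inside₁ q       = inside₁ (e ∷ q)
  ... | inside₂ q       = through (arc-tgt D₁ e , path-source D₂ q) [ inj₁ e ] (trcl-map inj₂ q)
  ... | through c p₁ p₂ = through c (inj₁ e ∷ p₁) p₂
  crossing (inj₂ e ∷ p) with crossing p
  ... | inside₁ q       = through (path-source D₁ q , arc-tgt D₂ e) [ inj₂ e ] (trcl-map inj₁ q)
  ... | inside₂ q       = inside₂ (e ∷ q)
  ... | through c p₁ p₂ = through c (inj₂ e ∷ p₁) p₂

  Acyclic-∪ : {A : Subset V} → Common ⊆ A → Acyclic D₁ → Acyclic D₂ →
              Irreflexive (Con A (D₁ ∪ᴰ D₂)) → Acyclic (D₁ ∪ᴰ D₂)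
  Acyclic-∪ Common⊆A acyclic₁ acyclic₂ irrefl v cycle with crossing cycle
  ... | inside₁ q       = acyclic₁ v q
  ... | inside₂ q       = acyclic₂ v q
  ... | through c p₁ p₂ = irrefl _ (Common⊆A c , Common⊆A c , p₂ ++ p₁)

  module Segments (V₁ V₂ : Subset V)
      (Common⊆V₁ : Common ⊆ V₁) (V₁⊆D₁ : V₁ ⊆ vertex D₁)
      (Common⊆V₂ : Common ⊆ V₂) (V₂⊆D₂ : V₂ ⊆ vertex D₂) where

    Step : BRel V
    Step = Con V₁ D₁ ∪ᵣ Con V₂ D₂

    vertex₁-∈-V₁ : ∀ {y} → vertex D₁ y → (V₁ ∪ₛ V₂) y → V₁ y
    vertex₁-∈-V₁ d (inj₁ v) = v
    vertex₁-∈-V₁ d (inj₂ v) = Common⊆V₁ (d , V₂⊆D₂ v)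

    vertex₂-∈-V₂ : ∀ {y} → vertex D₂ y → (V₁ ∪ₛ V₂) y → V₂ y
    vertex₂-∈-V₂ d (inj₁ v) = Common⊆V₂ (V₁⊆D₁ v , d)
    vertex₂-∈-V₂ d (inj₂ v) = v

    data Segmented (x y : V) : Set where
      last₁ : Path D₁ x y → V₁ y → Segmented x y
      last₂ : Path D₂ x y → V₂ y → Segmented x y
      then₁ : ∀ {w} → Path D₁ x w → Common w → trcl Step w y → Segmented x y
      then₂ : ∀ {w} → Path D₂ x w → Common w → trcl Step w y → Segmented x y

    segmented : ∀ {x y} → Path (D₁ ∪ᴰ D₂) x y → (V₁ ∪ₛ V₂) y → Segmented x y
    segmented [ inj₁ e ] wy = last₁ [ e ] (vertex₁-∈-V₁ (arc-tgt D₁ e) wy)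
    segmented [ inj₂ e ] wy = last₂ [ e ] (vertex₂-∈-V₂ (arc-tgt D₂ e) wy)
    segmented (inj₁ e ∷ p) wy with segmented p wy
    ... | last₁ q v   = last₁ (e ∷ q) v
    ... | last₂ q v   = then₁ [ e ] c [ inj₂ (Common⊆V₂ c , v , q) ]
      where c = (arc-tgt D₁ e , path-source D₂ q)
    ... | then₁ q c t = then₁ (e ∷ q) c t
    ... | then₂ q c t = then₁ [ e ] c′ (inj₂ (Common⊆V₂ c′ , Common⊆V₂ c , q) ∷ t)
      where c′ = (arc-tgt D₁ e , path-source D₂ q)
    segmented (inj₂ e ∷ p) wy with segmented p wy
    ... | last₁ q v   = then₂ [ e ] c [ inj₁ (Common⊆V₁ c , v , q) ]
      where c = (path-source D₁ q , arc-tgt D₂ e)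
    ... | last₂ q v   = last₂ (e ∷ q) v
    ... | then₁ q c t = then₂ [ e ] c′ (inj₁ (Common⊆V₁ c′ , Common⊆V₁ c , q) ∷ t)
      where c′ = (path-source D₁ q , arc-tgt D₂ e)
    ... | then₂ q c t = then₂ (e ∷ q) c t

    Con⇒trcl-Step : Con (V₁ ∪ₛ V₂) (D₁ ∪ᴰ D₂) ⇒ trcl Step
    Con⇒trcl-Step (wx , wy , p) with segmented p wy
    ... | last₁ q v   = [ inj₁ (vertex₁-∈-V₁ (path-source D₁ q) wx , v , q) ]
    ... | last₂ q v   = [ inj₂ (vertex₂-∈-V₂ (path-source D₂ q) wx , v , q) ]
    ... | then₁ q c t = inj₁ (vertex₁-∈-V₁ (path-source D₁ q) wx , Common⊆V₁ c , q) ∷ t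
    ... | then₂ q c t = inj₂ (vertex₂-∈-V₂ (path-source D₂ q) wx , Common⊆V₂ c , q) ∷ t

    trcl-Step⇒Con : trcl Step ⇒ Con (V₁ ∪ₛ V₂) (D₁ ∪ᴰ D₂)
    trcl-Step⇒Con = trcl-least Step⇒Con (Con-trans {D = D₁ ∪ᴰ D₂})
      where
      Step⇒Con : Step ⇒ Con (V₁ ∪ₛ V₂) (D₁ ∪ᴰ D₂)
      Step⇒Con (inj₁ (ax , ay , p)) = inj₁ ax , inj₁ ay , trcl-map inj₁ p
      Step⇒Con (inj₂ (ax , ay , p)) = inj₂ ax , inj₂ ay , trcl-map inj₂ p

lemma3 : {V : Set} (D₁ D₂ : Digraph V) (V₁ V₂ : Subset V) →
    (vertex D₁ ∩ₛ vertex D₂) ⊆ V₁ → V₁ ⊆ vertex D₁ →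
    (vertex D₁ ∩ₛ vertex D₂) ⊆ V₂ → V₂ ⊆ vertex D₂ →
    (Con (V₁ ∪ₛ V₂) (D₁ ∪ᴰ D₂) ≐ trcl (Con V₁ D₁ ∪ᵣ Con V₂ D₂))
    × (Acyclic D₁ → Acyclic D₂ → Irreflexive (Con (V₁ ∪ₛ V₂) (D₁ ∪ᴰ D₂)) →
    Acyclic (D₁ ∪ᴰ D₂))
lemma3 D₁ D₂ V₁ V₂ Common⊆V₁ V₁⊆D₁ Common⊆V₂ V₂⊆D₂ =
  (λ _ _ → Con⇒trcl-Step , trcl-Step⇒Con) , Acyclic-∪ (λ c → inj₁ (Common⊆V₁ c))
  where
  open Union D₁ D₂
  open Segments V₁ V₂ Common⊆V₁ V₁⊆D₁ Common⊆V₂ V₂⊆D₂
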